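{- If $Y$ is a minimally non-firm generalised binary matrix, then $i(Y)=br(Y)-1$.
   Context: A generalised binary matrix is a matrix $Y$ with entries in $\{0,1,?\}$; $\operatorname{supp}(Y)$ is the set of positions of entries equal to $1$. A rectangle is a submatrix $I\times J$ containing no $0$. $br(Y)$ is the minimum number of rectangles whose union contains $\operatorname{supp}(Y)$; an isolated set is a subset of $\operatorname{supp}(Y)$ no two elements of which lie in a common rectangle, and $i(Y)$ is the maximum size of an isolated set. $Y$ is minimally non-firm if $i(Y)<br(Y)$ and $i(Y')=br(Y')$ for every proper submatrix $Y'$ of $Y$ (obtained by deleting at least one row or column). -}

module Defs where

open import Data.Nat using (ℕ; _<_; _⊔_)
open import Data.Fin using (Fin)
open import Data.Fin.Subset using (Subset; _∈_)
open import Data.Product using (_×_; _,_; ∃; ∃-syntax; Σ-syntax)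
open import Data.Sum using (_⊎_)
open import Data.List using (List; length)
open import Data.List.Relation.Unary.All using (All)
open import Data.List.Relation.Unary.Any using (Any)
import Data.List.Membership.Propositional as LM
open import Data.List.Relation.Unary.Unique.Propositional using (Unique)
open import Function.Definitions using (Injective)
open import Relation.Binary.PropositionalEquality using (_≡_; _≢_)
open import Relation.Nullary using (¬_)

data Entry : Set where
  e0 e1 e? : Entry

GMatrix : ℕ → ℕ → Set
GMatrix m n = Fin m → Fin n → Entry

Pos : ℕ → ℕ → Set
Pos m n = Fin m × Fin n

InSupp : ∀ {m n} → GMatrix m n → Pos m n → Set
InSupp Y (i , j) = Y i j ≡ e1

Rect : ℕ → ℕ → Set
Rect m n = Subset m × Subset n

IsRectangle : ∀ {m n} → GMatrix m n → Rect m n → Set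
IsRectangle Y (I , J) = ∀ i j → i ∈ I → j ∈ J → Y i j ≢ e0

_∈R_ : ∀ {m n} → Pos m n → Rect m n → Set
(i , j) ∈R (I , J) = i ∈ I × j ∈ J

IsCover : ∀ {m n} → GMatrix m n → List (Rect m n) → Set
IsCover Y rs = All (IsRectangle Y) rs × (∀ p → InSupp Y p → Any (p ∈R_) rs)

IsBr : ∀ {m n} → GMatrix m n → ℕ → Set
IsBr Y k = (∃[ rs ] (IsCover Y rs × length rs ≡ k))
         × (∀ rs → IsCover Y rs → k Data.Nat.≤ length rs)

CommonRect : ∀ {m n} → GMatrix m n → Pos m n → Pos m n → Set
CommonRect Y p q = ∃[ r ] (IsRectangle Y r × p ∈R r × q ∈R r)

IsIsolated : ∀ {m n} → GMatrix m n → List (Pos m n) → Set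
IsIsolated Y s = Unique s × All (InSupp Y) s
               × (∀ p q → p LM.∈ s → q LM.∈ s → p ≢ q → ¬ CommonRect Y p q)

IsI : ∀ {m n} → GMatrix m n → ℕ → Set
IsI Y k = (∃[ s ] (IsIsolated Y s × length s ≡ k))
        × (∀ s → IsIsolated Y s → length s Data.Nat.≤ k)

record ProperSub {m n m' n'} (Y : GMatrix m n) (Y' : GMatrix m' n') : Set where
  field
    rowMap : Fin m' → Fin m
    colMap : Fin n' → Fin n
    rowInj : Injective _≡_ _≡_ rowMap
    colInj : Injective _≡_ _≡_ colMap
    proper : m' < m ⊎ n' < n
    entries : ∀ i j → Y' i j ≡ Y (rowMap i) (colMap j)

Firm : ∀ {m n} → GMatrix m n → Set
Firm Y = ∀ a b → IsI Y a → IsBr Y b → a ≡ b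

MinimallyNonFirm : ∀ {m n} → GMatrix m n → Set
MinimallyNonFirm {m} {n} Y =
  (∃[ a ] ∃[ b ] (IsI Y a × IsBr Y b × a < b))
  × (∀ m' n' (Y' : GMatrix m' n') → ProperSub Y Y' → Firm Y')

-- Deleting the first row of Y gives a proper submatrix Y', which is firm.
-- Isolated sets of a submatrix are isolated in the matrix, so i(Y') ≤ i(Y);
-- a cover of Y' together with one rectangle for the deleted row covers Y, so
-- br(Y) ≤ br(Y') + 1.  Hence br(Y) ≤ i(Y') + 1 ≤ i(Y) + 1, while i(Y) < br(Y).
-- The optima i(Y') and br(Y') exist only classically; since the conclusion is
-- a decidable equation of naturals, the argument runs in the double-negation
-- monad.
module Submission where

open import Defs
open import Data.Nat using (ℕ; _∸_)
open import Relation.Binary.PropositionalEquality using (_≡_)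

open import Data.Nat using (zero; suc; pred; _≤_; _<_; z≤n; s≤s; s≤s⁻¹)
open import Data.Nat.Properties using (≤-trans; ≤-antisym; ≤-reflexive; ≤∧≢⇒<; ≮⇒≥; m<1+n⇒m<n∨m≡n; n≮0; <-irrefl; _≟_)
open import Data.Bool using (Bool; true; false)
open import Data.Fin as Fin using (Fin)
open import Data.Fin.Properties using (suc-injective)
open import Data.Fin.Subset using (Subset; _∈_; outside; ⁅_⁆)
open import Data.Fin.Subset.Properties using (x∈⁅x⁆; x∈⁅y⁆⇒x≡y)
open import Data.Vec using (_∷_; there; tabulate; lookup)
open import Data.Vec.Properties using (lookup∘tabulate; lookup⇒[]=; []=⇒lookup)
open import Data.Product using (_×_; _,_; ∃; ∃-syntax; proj₁; proj₂)
open import Data.Sum using (inj₁; inj₂)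
open import Data.Empty using (⊥-elim)
open import Data.List using (List; []; _∷_; length; map)
open import Data.List.Properties using (length-map)
open import Data.List.Relation.Unary.All as All using (All)
import Data.List.Relation.Unary.All.Properties as All
open import Data.List.Relation.Unary.Any as Any using (Any)
import Data.List.Relation.Unary.Any.Properties as Any
import Data.List.Relation.Unary.AllPairs as AllPairs
import Data.List.Relation.Unary.Unique.Propositional.Properties as Unique
import Data.List.Membership.Propositional as List
open import Data.List.Membership.Propositional.Properties using (∈-map⁻)
open import Effect.Monad using (RawMonad)
open import Level using (0ℓ)
open import Relation.Binary.PropositionalEquality using (_≢_; refl; sym; trans; cong; cong₂; subst; subst₂)
open import Function using (_∘_)
open import Relation.Nullary using (¬_; yes; no)
open import Relation.Nullary.Decidable using (decidable-stable; ¬¬-excluded-middle)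
open import Relation.Nullary.Negation using (¬¬-Monad)

open RawMonad (¬¬-Monad {a = 0ℓ})

∈-tabulate⁺ : ∀ {n} (f : Fin n → Bool) {i} → f i ≡ true → i ∈ tabulate f
∈-tabulate⁺ f {i} fi = lookup⇒[]= i (tabulate f) (trans (lookup∘tabulate f i) fi)

∈-tabulate⁻ : ∀ {n} (f : Fin n → Bool) {i} → i ∈ tabulate f → f i ≡ true
∈-tabulate⁻ f {i} i∈ = trans (sym (lookup∘tabulate f i)) ([]=⇒lookup i∈)

preimage : ∀ {m n} → (Fin m → Fin n) → Subset n → Subset m
preimage f I = tabulate (λ i → lookup I (f i))

∈-preimage⁻ : ∀ {m n} (f : Fin m → Fin n) {I i} → i ∈ preimage f I → f i ∈ I
∈-preimage⁻ f {I} {i} i∈ = lookup⇒[]= (f i) I (∈-tabulate⁻ (λ i → lookup I (f i)) i∈)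

∈-preimage⁺ : ∀ {m n} (f : Fin m → Fin n) {I i} → f i ∈ I → i ∈ preimage f I
∈-preimage⁺ f {I} fi∈ = ∈-tabulate⁺ (λ i → lookup I (f i)) ([]=⇒lookup fi∈)

Greatest : (ℕ → Set) → Set
Greatest P = ∃[ k ] (P k × (∀ j → P j → j ≤ k))

Least : (ℕ → Set) → Set
Least P = ∃[ k ] (P k × (∀ j → P j → k ≤ j))

¬¬-greatest : ∀ {P : ℕ → Set} B {k} → (∀ j → P j → j ≤ B) → P k → ¬ ¬ Greatest P
¬¬-greatest zero {k} bounded pk = pure (k , pk , λ j pj → ≤-trans (bounded j pj) z≤n)
¬¬-greatest (suc B) bounded pk = ¬¬-excluded-middle >>= λ where
  (yes pB) → pure (suc B , pB , bounded)
  (no ¬pB) → ¬¬-greatest B (λ j pj → s≤s⁻¹ (≤∧≢⇒< (bounded j pj) λ { refl → ¬pB pj })) pk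

-- The least k with P k is the greatest k below which P fails everywhere.
¬¬-least : ∀ {P : ℕ → Set} {n} → P n → ¬ ¬ Least P
¬¬-least {P} {n} pn = do
  (k , k-fails-below , k-greatest) ← ¬¬-greatest n {0} (λ k fails → ≮⇒≥ λ n<k → fails n n<k pn) (λ _ ())
  ¬¬-excluded-middle >>= λ where
    (yes pk) → pure (k , pk , λ j pj → ≮⇒≥ λ j<k → k-fails-below j j<k pj)
    (no ¬pk) → ⊥-elim (<-irrefl refl (k-greatest (suc k) (fails-below-suc k-fails-below ¬pk)))
  where
  FailsBelow : ℕ → Set
  FailsBelow k = ∀ j → j < k → ¬ P j
  fails-below-suc : ∀ {k} → FailsBelow k → ¬ P k → FailsBelow (suc k)
  fails-below-suc fails ¬pk j j<1+k with m<1+n⇒m<n∨m≡n j<1+k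
  ... | inj₁ j<k = fails j j<k
  ... | inj₂ refl = ¬pk

module _ {m n} (Y : GMatrix m n) where

  IsI-unique : ∀ {a a'} → IsI Y a → IsI Y a' → a ≡ a'
  IsI-unique ((s , iso , refl) , max) ((s' , iso' , refl) , max') =
    ≤-antisym (max' s iso) (max s' iso')

  IsBr-unique : ∀ {b b'} → IsBr Y b → IsBr Y b' → b ≡ b'
  IsBr-unique ((rs , cover , refl) , min) ((rs' , cover' , refl) , min') =
    ≤-antisym (min rs' cover') (min' rs cover)

  ¬¬-IsI : ∀ {B} → (∀ s → IsIsolated Y s → length s ≤ B) → ¬ ¬ ∃ (IsI Y)
  ¬¬-IsI {B} bounded = do
    (a , isolated , max) ← ¬¬-greatest B (λ { _ (s , iso , refl) → bounded s iso }) empty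
    pure (a , isolated , λ s iso → max (length s) (s , iso , refl))
    where
    empty : ∃[ s ] (IsIsolated Y s × length s ≡ 0)
    empty = [] , (AllPairs.[] , All.[] , λ _ _ ()) , refl

  ¬¬-IsBr : ∀ {rs} → IsCover Y rs → ¬ ¬ ∃ (IsBr Y)
  ¬¬-IsBr {rs} cover = do
    (b , covering , min) ← ¬¬-least (rs , cover , refl)
    pure (b , covering , λ rs' cover' → min (length rs') (rs' , cover' , refl))

IsBr-noRows : ∀ {n b} (Y : GMatrix 0 n) → IsBr Y b → b ≡ 0
IsBr-noRows Y (_ , min) = ≤-antisym (min [] (All.[] , λ { (() , _) _ })) z≤n

module Submatrix {m n m' n'} {Y : GMatrix m n} {Y' : GMatrix m' n'} (S : ProperSub Y Y') where
  open ProperSub S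

  embed : Pos m' n' → Pos m n
  embed (i , j) = rowMap i , colMap j

  embed-injective : ∀ {p q} → embed p ≡ embed q → p ≡ q
  embed-injective e = cong₂ _,_ (rowInj (cong proj₁ e)) (colInj (cong proj₂ e))

  restrict : Rect m n → Rect m' n'
  restrict (I , J) = preimage rowMap I , preimage colMap J

  ∈R-restrict⁺ : ∀ {p} r → embed p ∈R r → p ∈R restrict r
  ∈R-restrict⁺ r (i∈ , j∈) = ∈-preimage⁺ rowMap i∈ , ∈-preimage⁺ colMap j∈

  restrict-isRectangle : ∀ {r} → IsRectangle Y r → IsRectangle Y' (restrict r)
  restrict-isRectangle rect i j i∈ j∈ =
    subst (λ e → e ≢ e0) (sym (entries i j))
          (rect (rowMap i) (colMap j) (∈-preimage⁻ rowMap i∈) (∈-preimage⁻ colMap j∈))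

  embed-supp : ∀ {p} → InSupp Y' p → InSupp Y (embed p)
  embed-supp {i , j} p∈ = trans (sym (entries i j)) p∈

  restrict-commonRect : ∀ {p q} → CommonRect Y (embed p) (embed q) → CommonRect Y' p q
  restrict-commonRect (r , rect , p∈ , q∈) =
    restrict r , restrict-isRectangle rect , ∈R-restrict⁺ r p∈ , ∈R-restrict⁺ r q∈

  embed-isolated : ∀ {s} → IsIsolated Y' s → IsIsolated Y (map embed s)
  embed-isolated {s} (unique , supp , separated) =
    Unique.map⁺ embed-injective unique , All.map⁺ (All.map embed-supp supp) , separated′
    where
    separated′ : ∀ p q → p List.∈ map embed s →
                 q List.∈ map embed s →
                 p ≢ q → ¬ CommonRect Y p q
    separated′ _ _ p∈ q∈ p≢q with ∈-map⁻ embed p∈ | ∈-map⁻ embed q∈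
    ... | p' , p'∈ , refl | q' , q'∈ , refl =
      separated p' q' p'∈ q'∈ (λ { refl → p≢q refl }) ∘ restrict-commonRect

  restrict-cover : ∀ {rs} → IsCover Y rs → IsCover Y' (map restrict rs)
  restrict-cover (rects , covers) =
    All.map⁺ (All.map restrict-isRectangle rects) ,
    λ p p∈ → Any.map⁺ (Any.map (λ {r} → ∈R-restrict⁺ r) (covers (embed p) (embed-supp p∈)))

  isolated-length-≤-i : ∀ {a s} → IsI Y a → IsIsolated Y' s → length s ≤ a
  isolated-length-≤-i {s = s} (_ , max) iso =
    subst (_≤ _) (length-map embed s) (max (map embed s) (embed-isolated iso))

  i-mono : ∀ {a a'} → IsI Y a → IsI Y' a' → a' ≤ a
  i-mono iA ((s , iso , refl) , _) = isolated-length-≤-i iA iso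

nonzero : Entry → Bool
nonzero e0 = false
nonzero e1 = true
nonzero e? = true

nonzero⇒≢e0 : ∀ e → nonzero e ≡ true → e ≢ e0
nonzero⇒≢e0 e0 ()
nonzero⇒≢e0 e1 _ ()
nonzero⇒≢e0 e? _ ()

nonzeroColumns : ∀ {n} → (Fin n → Entry) → Subset n
nonzeroColumns row = tabulate (nonzero ∘ row)

module _ {m n} (Y : GMatrix (suc m) n) where

  dropFirstRow : GMatrix m n
  dropFirstRow i j = Y (Fin.suc i) j

  dropFirstRow-proper : ProperSub Y dropFirstRow
  dropFirstRow-proper = record
    { rowMap = Fin.suc ; colMap = λ j → j
    ; rowInj = suc-injective ; colInj = λ e → e
    ; proper = inj₁ (≤-reflexive refl) ; entries = λ _ _ → refl }

  firstRowRect : Rect (suc m) n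
  firstRowRect = ⁅ Fin.zero ⁆ , nonzeroColumns (Y Fin.zero)

  firstRowRect-isRectangle : IsRectangle Y firstRowRect
  firstRowRect-isRectangle i j i∈ j∈ with x∈⁅y⁆⇒x≡y Fin.zero i∈
  ... | refl = nonzero⇒≢e0 (Y Fin.zero j) (∈-tabulate⁻ (nonzero ∘ Y Fin.zero) j∈)

  extend : Rect m n → Rect (suc m) n
  extend (I , J) = outside ∷ I , J

  extend-isRectangle : ∀ {r} → IsRectangle dropFirstRow r → IsRectangle Y (extend r)
  extend-isRectangle rect (Fin.suc i) j (there i∈) j∈ = rect i j i∈ j∈

  ∈R-extend : ∀ {i j} r → (i , j) ∈R r → (Fin.suc i , j) ∈R extend r
  ∈R-extend r (i∈ , j∈) = there i∈ , j∈

  cover-addFirstRow : ∀ {rs} → IsCover dropFirstRow rs → IsCover Y (firstRowRect ∷ map extend rs)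
  cover-addFirstRow (rects , covers) =
    firstRowRect-isRectangle All.∷ All.map⁺ (All.map extend-isRectangle rects) , λ where
      (Fin.zero , j) p∈ → Any.here (x∈⁅x⁆ Fin.zero , ∈-tabulate⁺ (nonzero ∘ Y Fin.zero) (cong nonzero p∈))
      (Fin.suc i , j) p∈ → Any.there (Any.map⁺ (Any.map (λ {r} → ∈R-extend r) (covers (i , j) p∈)))

  br-dropFirstRow : ∀ {b b'} → IsBr Y b → IsBr dropFirstRow b' → b ≤ suc b'
  br-dropFirstRow {b} (_ , min) ((rs , cover , refl) , _) =
    subst (b ≤_) (cong suc (length-map extend rs)) (min _ (cover-addFirstRow cover))

lemma6 : ∀ {m n} (Y : GMatrix m n) → MinimallyNonFirm Y →
         ∀ a b → IsI Y a → IsBr Y b → a ≡ b ∸ 1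
lemma6 {zero} Y ((_ , _ , _ , iB₀ , a₀<b₀) , _) _ _ _ _ =
  ⊥-elim (n≮0 (subst (_ <_) (IsBr-noRows Y iB₀) a₀<b₀))
lemma6 {suc m} {n} Y ((_ , _ , iA₀ , iB₀ , a₀<b₀) , minimal) a b iA iB@((_ , cover , _) , _) =
  decidable-stable (a ≟ b ∸ 1) do
    (a' , iA') ← ¬¬-IsI Y' (λ _ → isolated-length-≤-i iA)
    (b' , iB') ← ¬¬-IsBr Y' (restrict-cover cover)
    let a'≡b' = minimal m n Y' S a' b' iA' iB'
        b≤1+a = ≤-trans (br-dropFirstRow Y iB iB') (s≤s (subst (_≤ a) a'≡b' (i-mono iA iA')))
    pure (sym (cong pred (≤-antisym b≤1+a a<b)))
  where
  Y' : GMatrix m n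
  Y' = dropFirstRow Y
  S : ProperSub Y Y'
  S = dropFirstRow-proper Y
  open Submatrix S
  a<b : a < b
  a<b = subst₂ _<_ (IsI-unique Y iA₀ iA) (IsBr-unique Y iB₀ iB) a₀<b₀
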